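{- Let $N$ be a $k$-XOR circulant network of size $n$ with automata set $V$ and global transition function $F$ (parallel updating). Then the maximum, over all configurations $x\in\{0,1\}^n$, of the convergence time (transient length) of $x$ is attained by configurations of density $\frac1n$. Moreover, let $p_\ast$ be the period of the attractors reached by configurations of density $\frac1n$; then for every configuration $x\in\{0,1\}^n$, the period of the attractor reached from $x$ divides $p_\ast$.
   Context: For integers $k\ge 2$ and $n\ge k$, a $k$-XOR circulant network of size $n$ has automata $V=\{0,\ldots,n-1\}$, configurations $x\in\{0,1\}^n$, and an interaction matrix $\mathcal{C}$ ($n\times n$, $0/1$, $\mathcal{C}_{i,j}=1$ iff automaton $j$ influences automaton $i$) which is circulant, $\mathcal{C}_{i,j}=c_{(j-i)\bmod n}$ for some $(c_0,\ldots,c_{n-1})$, has exactly $k$ ones in each row, and satisfies $c_{n-1}=1$; the local functions are $f_i(x)=\sum_j\mathcal{C}_{i,j}x_j\bmod 2$ and under parallel updating the dynamics is $x(t+1)=F(x(t))$ with $F(x)=\mathcal{C}x\bmod 2$. The density of $x$ is $d(x)=\frac1n|\{i: x_i=1\}|$ (so density $\frac1n$ means exactly one automaton has state $1$). Since $F$ is a map on a finite set, every trajectory $(F^t(x))_t$ eventually enters a cycle (its attractor, a limit cycle); the convergence time of $x$ is the least $t$ such that $F^t(x)$ lies on this cycle, and the period of the attractor is the length of the cycle. -}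

module Defs where

open import Data.Nat using (ℕ; zero; suc; _+_; _∸_; _<_; _≤_)
open import Data.Nat.DivMod using (_mod_)
open import Data.Bool using (Bool; true; false; _xor_; _∧_)
open import Data.Bool.Properties using () renaming (_≟_ to _≟ᵇ_)
open import Data.Fin using (Fin; toℕ; fromℕ)
open import Data.Vec using (Vec; lookup; tabulate; foldr; count)
open import Data.Product using (Σ; _×_; ∃)
open import Relation.Binary.PropositionalEquality using (_≡_)
open import Relation.Nullary using (¬_)

Config : ℕ → Set
Config n = Vec Bool n

diffMod : ∀ {n} → Fin n → Fin n → Fin n
diffMod {suc m} i j = (toℕ j + suc m ∸ toℕ i) mod suc m

-- Circulant interaction matrix from its first row (c_0, …, c_{n-1}):
-- C i j = c_{(j - i) mod n}
circ : ∀ {n} → Vec Bool n → Fin n → Fin n → Bool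
circ c i j = lookup c (diffMod i j)

xorSum : ∀ {n} → Vec Bool n → Bool
xorSum = foldr _ _xor_ false

F : ∀ {n} → Vec Bool n → Config n → Config n
F c x = tabulate (λ i → xorSum (tabulate (λ j → circ c i j ∧ lookup x j)))

iter : ∀ {A : Set} → (A → A) → ℕ → A → A
iter f zero a = a
iter f (suc t) a = f (iter f t a)

ones : ∀ {n} → Vec Bool n → ℕ
ones v = count (_≟ᵇ true) v

IsKXorCirculant : (k n : ℕ) → Vec Bool n → Set
IsKXorCirculant k n c =
  (2 ≤ k) × (k ≤ n) × (ones c ≡ k) × (Σ (Fin n) λ last → (toℕ last ≡ n ∸ 1) × (lookup c last ≡ true))

OnCycle : ∀ {n} → Vec Bool n → Config n → Set
OnCycle c y = Σ ℕ λ p → (0 < p) × (iter (F c) p y ≡ y)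

IsConvTime : ∀ {n} → Vec Bool n → Config n → ℕ → Set
IsConvTime c x t = OnCycle c (iter (F c) t x) × (∀ s → s < t → ¬ OnCycle c (iter (F c) s x))

IsPeriod : ∀ {n} → Vec Bool n → Config n → ℕ → Set
IsPeriod c x p =
  (0 < p) × (∃ λ t → iter (F c) (t + p) x ≡ iter (F c) t x)
  × (∀ q → 0 < q → q < p → ¬ (∃ λ t → iter (F c) (t + q) x ≡ iter (F c) t x))

-- F is linear over GF(2) and commutes with the cyclic rotation of the automata.
-- The configurations of density 1/n are rotations of one another and span
-- {0,1}^n, so F^a and F^b agree everywhere as soon as they agree on one such
-- configuration e. Hence every orbit is periodic from the transient time of e,
-- with the period of e; the transient of any x is therefore at most that of e,
-- and its period divides that of e because the least eventual period of an
-- orbit divides all of its eventual periods.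
module Submission where

open import Defs
open import Algebra.Bundles using (CommutativeRing; CommutativeMonoid)
open import Data.Bool using (Bool; true; false; _xor_; _∧_)
open import Data.Bool.Properties
  using (∧-distribˡ-xor; ∧-zeroʳ; xor-∧-commutativeRing)
  renaming (_≟_ to _≟ᵇ_)
open import Data.Empty using (⊥-elim)
open import Data.Fin as Fin using (Fin; toℕ; fromℕ; inject₁; combine)
open import Data.Fin.Properties
  using ( toℕ-fromℕ<; toℕ-fromℕ; toℕ-inject₁; toℕ-injective; toℕ<n
        ; pigeonhole; combine-injective; 2↔Bool )
  renaming (_≟_ to _≟ᶠ_)
open import Data.Nat
open import Data.Nat.DivMod
open import Data.Nat.Divisibility using (_∣_; m%n≡0⇒n∣m)
open import Data.Nat.Induction using (<-rec)
open import Data.Nat.Properties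
open import Data.Product using (Σ; ∃; ∃₂; _×_; _,_)
open import Data.Vec using (Vec; []; _∷_; lookup; tabulate; zipWith; replicate)
open import Data.Vec.Properties
  using ( lookup∘tabulate; tabulate∘lookup; tabulate-cong; lookup-zipWith; lookup-replicate
        ; zipWith-identityˡ; ≡-dec )
open import Function.Bundles using (_↣_; Injection)
open import Function.Properties.Inverse using (↔-sym; ↔⇒↣)
open import Relation.Nullary using (¬_; Dec; yes; no; contradiction)
open import Relation.Binary.PropositionalEquality
open import Algebra.Properties.CommutativeSemigroup
  (CommutativeMonoid.commutativeSemigroup (CommutativeRing.+-commutativeMonoid xor-∧-commutativeRing))
  using (interchange; x∙yz≈y∙xz)

module _ {A : Set} (f : A → A) where

  iter-+ : ∀ m n x → iter f (m + n) x ≡ iter f m (iter f n x)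
  iter-+ zero    n x = refl
  iter-+ (suc m) n x = cong f (iter-+ m n x)

  iter-fixed : ∀ {a} → f a ≡ a → ∀ t → iter f t a ≡ a
  iter-fixed fa≡a zero    = refl
  iter-fixed fa≡a (suc t) = trans (cong f (iter-fixed fa≡a t)) fa≡a

  iter-commute : ∀ (g : A → A) → (∀ x → f (g x) ≡ g (f x)) →
                 ∀ t x → iter f t (g x) ≡ g (iter f t x)
  iter-commute g fg≡gf zero    x = refl
  iter-commute g fg≡gf (suc t) x = trans (cong f (iter-commute g fg≡gf t x)) (fg≡gf _)

  iter-homo₂ : ∀ (_∙_ : A → A → A) → (∀ x y → f (x ∙ y) ≡ f x ∙ f y) →
               ∀ t x y → iter f t (x ∙ y) ≡ iter f t x ∙ iter f t y
  iter-homo₂ _∙_ homo zero    x y = refl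
  iter-homo₂ _∙_ homo (suc t) x y = trans (cong f (iter-homo₂ _∙_ homo t x y)) (homo _ _)

  iter-+-comm : ∀ x u q → iter f (u + q) x ≡ iter f q (iter f u x)
  iter-+-comm x u q = trans (cong (λ t → iter f t x) (+-comm u q)) (iter-+ q u x)

module _ {A : Set} (f : A → A) (x : A) where

  PeriodicFrom : ℕ → ℕ → Set
  PeriodicFrom u q = iter f (u + q) x ≡ iter f u x

  private
    orbit : ℕ → A
    orbit t = iter f t x

  periodicFrom-mono : ∀ {u v} q → u ≤ v → PeriodicFrom u q → PeriodicFrom v q
  periodicFrom-mono {u} {v} q u≤v periodic = begin
    orbit (v + q)                      ≡⟨ cong (λ t → orbit (t + q)) (sym (m∸n+n≡m u≤v)) ⟩
    orbit ((v ∸ u + u) + q)            ≡⟨ cong orbit (+-assoc (v ∸ u) u q) ⟩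
    orbit (v ∸ u + (u + q))            ≡⟨ iter-+ f (v ∸ u) (u + q) x ⟩
    iter f (v ∸ u) (orbit (u + q))     ≡⟨ cong (iter f (v ∸ u)) periodic ⟩
    iter f (v ∸ u) (orbit u)           ≡⟨ iter-+ f (v ∸ u) u x ⟨
    orbit (v ∸ u + u)                  ≡⟨ cong orbit (m∸n+n≡m u≤v) ⟩
    orbit v                            ∎
    where open ≡-Reasoning

  periodicFrom-* : ∀ u q k → PeriodicFrom u q → PeriodicFrom u (k * q)
  periodicFrom-* u q zero    periodic = cong orbit (+-identityʳ u)
  periodicFrom-* u q (suc k) periodic = begin
    orbit (u + (q + k * q))   ≡⟨ cong (λ r → orbit (u + r)) (+-comm q (k * q)) ⟩
    orbit (u + (k * q + q))   ≡⟨ cong orbit (+-assoc u (k * q) q) ⟨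
    orbit (u + k * q + q)     ≡⟨ periodicFrom-mono q (m≤m+n u (k * q)) periodic ⟩
    orbit (u + k * q)         ≡⟨ periodicFrom-* u q k periodic ⟩
    orbit u                   ∎
    where open ≡-Reasoning

  -- Wind the orbit forward by t * q steps, which lands past t and changes nothing.
  periodicFrom-swapPeriod : ∀ s q t p → 0 < q → PeriodicFrom s q → PeriodicFrom t p → PeriodicFrom s p
  periodicFrom-swapPeriod s q t p q>0 periodic-q periodic-p = begin
    orbit (s + p)              ≡⟨ periodicFrom-* (s + p) q t (periodicFrom-mono q (m≤m+n s p) periodic-q) ⟨
    orbit (s + p + t * q)      ≡⟨ cong orbit (+-assoc s p (t * q)) ⟩
    orbit (s + (p + t * q))    ≡⟨ cong (λ r → orbit (s + r)) (+-comm p (t * q)) ⟩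
    orbit (s + (t * q + p))    ≡⟨ cong orbit (+-assoc s (t * q) p) ⟨
    orbit (s + t * q + p)      ≡⟨ periodicFrom-mono p t≤s+t*q periodic-p ⟩
    orbit (s + t * q)          ≡⟨ periodicFrom-* s q t periodic-q ⟩
    orbit s                    ∎
    where
      open ≡-Reasoning
      instance _ = >-nonZero q>0
      t≤s+t*q : t ≤ s + t * q
      t≤s+t*q = ≤-trans (m≤m*n t q) (m≤n+m (t * q) s)

  periodicFrom-% : ∀ t p u q .{{_ : NonZero p}} → PeriodicFrom t p → PeriodicFrom u q →
                   PeriodicFrom (u + t) (q % p)
  periodicFrom-% t p u q periodic-p periodic-q = begin
    orbit (u + t + q % p)
      ≡⟨ periodicFrom-* (u + t + q % p) p (q / p) (periodicFrom-mono p t≤ periodic-p) ⟨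
    orbit (u + t + q % p + q / p * p)     ≡⟨ cong orbit (+-assoc (u + t) (q % p) (q / p * p)) ⟩
    orbit (u + t + (q % p + q / p * p))   ≡⟨ cong (λ r → orbit (u + t + r)) (m≡m%n+[m/n]*n q p) ⟨
    orbit (u + t + q)                     ≡⟨ periodicFrom-mono q (m≤m+n u t) periodic-q ⟩
    orbit (u + t)                         ∎
    where
      open ≡-Reasoning
      t≤ : t ≤ u + t + q % p
      t≤ = ≤-trans (m≤n+m t u) (m≤m+n (u + t) (q % p))

  minimalPeriod-∣ : ∀ t p u q → 0 < p → PeriodicFrom t p →
                    (∀ r → 0 < r → r < p → ¬ ∃ λ s → PeriodicFrom s r) →
                    PeriodicFrom u q → p ∣ q
  minimalPeriod-∣ t p@(suc _) u q z<s periodic-p minimal periodic-q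
    with q % p in q%p≡r | periodicFrom-% t p u q periodic-p periodic-q
  ... | zero  | _          = m%n≡0⇒n∣m q p q%p≡r
  ... | suc r | periodic-r = contradiction (u + t , periodic-r)
                               (minimal (suc r) z<s (subst (_< p) q%p≡r (m%n<n q p)))

least-witness : ∀ {P : ℕ → Set} → (∀ n → Dec (P n)) → ∀ t → P t →
                Σ ℕ λ s → P s × (∀ r → r < s → ¬ P r)
least-witness {P} P? t = <-rec (λ t → P t → Σ ℕ λ s → P s × (∀ r → r < s → ¬ P r)) step t
  where
    step : ∀ t → (∀ {r} → r < t → P r → Σ ℕ λ s → P s × (∀ r → r < s → ¬ P r)) →
           P t → Σ ℕ λ s → P s × (∀ r → r < s → ¬ P r)
    step t smaller Pt with anyUpTo? P? t
    ... | yes (r , r<t , Pr) = smaller r<t Pr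
    ... | no none-below = t , Pt , λ r r<t Pr → none-below (r , r<t , Pr)

bits↣Fin : ∀ {n} → Vec Bool n ↣ Fin (2 ^ n)
bits↣Fin = record { to = encode ; cong = cong encode ; injective = encode-injective _ _ }
  where
    bit : Bool ↣ Fin 2
    bit = ↔⇒↣ (↔-sym 2↔Bool)
    encode : ∀ {n} → Vec Bool n → Fin (2 ^ n)
    encode []      = Fin.zero
    encode (b ∷ v) = combine (Injection.to bit b) (encode v)
    encode-injective : ∀ {n} (x y : Vec Bool n) → encode x ≡ encode y → x ≡ y
    encode-injective []      []      _  = refl
    encode-injective (a ∷ x) (b ∷ y) eq =
      let a≡b , x≡y = combine-injective _ (encode x) _ (encode y) eq
      in cong₂ _∷_ (Injection.injective bit a≡b) (encode-injective x y x≡y)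

eventually-periodic : ∀ {n} (G : Vec Bool n → Vec Bool n) x → ∃₂ λ t p → 0 < p × PeriodicFrom G x t p
eventually-periodic {n} G x
  with i , j , i<j , same ← pigeonhole (n<1+n (2 ^ n)) (λ i → Injection.to bits↣Fin (iter G (toℕ i) x)) =
  toℕ i , toℕ j ∸ toℕ i , m<n⇒0<n∸m i<j ,
  trans (cong (λ t → iter G t x) (m+[n∸m]≡n (<⇒≤ i<j))) (sym (Injection.injective bits↣Fin same))

infixl 6 _⊕_
_⊕_ : ∀ {n} → Vec Bool n → Vec Bool n → Vec Bool n
_⊕_ = zipWith _xor_

zeros : ∀ n → Vec Bool n
zeros n = replicate n false

lookup-ext : ∀ {n} {x y : Vec Bool n} → (∀ i → lookup x i ≡ lookup y i) → x ≡ y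
lookup-ext {x = x} {y} pointwise =
  trans (sym (tabulate∘lookup x)) (trans (tabulate-cong pointwise) (tabulate∘lookup y))

xorSum-xor : ∀ {n} (g h : Fin n → Bool) →
             xorSum (tabulate (λ j → g j xor h j)) ≡ xorSum (tabulate g) xor xorSum (tabulate h)
xorSum-xor {zero}  g h = refl
xorSum-xor {suc n} g h =
  trans (cong ((g Fin.zero xor h Fin.zero) xor_) (xorSum-xor (λ j → g (Fin.suc j)) (λ j → h (Fin.suc j))))
        (interchange (g Fin.zero) (h Fin.zero) _ _)

xorSum-false : ∀ n → xorSum (tabulate {n = n} (λ _ → false)) ≡ false
xorSum-false zero    = refl
xorSum-false (suc n) = xorSum-false n

xorSum-last : ∀ m (h : Fin (suc m) → Bool) →
              xorSum (tabulate h) ≡ h (fromℕ m) xor xorSum (tabulate (λ j → h (inject₁ j)))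
xorSum-last zero    h = refl
xorSum-last (suc m) h =
  trans (cong (h Fin.zero xor_) (xorSum-last m (λ j → h (Fin.suc j))))
        (x∙yz≈y∙xz (h Fin.zero) (h (fromℕ (suc m))) _)

lookup-F : ∀ {n} (c : Vec Bool n) x i →
           lookup (F c x) i ≡ xorSum (tabulate (λ j → circ c i j ∧ lookup x j))
lookup-F c x i = lookup∘tabulate _ i

F-⊕ : ∀ {n} (c : Vec Bool n) x y → F c (x ⊕ y) ≡ F c x ⊕ F c y
F-⊕ c x y = lookup-ext λ i → begin
  lookup (F c (x ⊕ y)) i
    ≡⟨ lookup-F c (x ⊕ y) i ⟩
  xorSum (tabulate (λ j → circ c i j ∧ lookup (x ⊕ y) j))
    ≡⟨ cong xorSum (tabulate-cong λ j →
         trans (cong (circ c i j ∧_) (lookup-zipWith _xor_ j x y)) (∧-distribˡ-xor (circ c i j) _ _)) ⟩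
  xorSum (tabulate (λ j → (circ c i j ∧ lookup x j) xor (circ c i j ∧ lookup y j)))
    ≡⟨ xorSum-xor (λ j → circ c i j ∧ lookup x j) (λ j → circ c i j ∧ lookup y j) ⟩
  xorSum (tabulate (λ j → circ c i j ∧ lookup x j)) xor xorSum (tabulate (λ j → circ c i j ∧ lookup y j))
    ≡⟨ cong₂ _xor_ (lookup-F c x i) (lookup-F c y i) ⟨
  lookup (F c x) i xor lookup (F c y) i
    ≡⟨ lookup-zipWith _xor_ i (F c x) (F c y) ⟨
  lookup (F c x ⊕ F c y) i ∎
  where open ≡-Reasoning

F-zeros : ∀ {n} (c : Vec Bool n) → F c (zeros n) ≡ zeros n
F-zeros {n} c = lookup-ext λ i → begin
  lookup (F c (zeros n)) i                              ≡⟨ lookup-F c (zeros n) i ⟩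
  xorSum (tabulate (λ j → circ c i j ∧ lookup (zeros n) j))
    ≡⟨ cong xorSum (tabulate-cong λ j →
         trans (cong (circ c i j ∧_) (lookup-replicate j false)) (∧-zeroʳ _)) ⟩
  xorSum (tabulate {n = n} (λ _ → false))               ≡⟨ xorSum-false n ⟩
  false                                                 ≡⟨ lookup-replicate i false ⟨
  lookup (zeros n) i                                    ∎
  where open ≡-Reasoning

unit : ∀ {n} → Fin n → Vec Bool n
unit {suc n} Fin.zero    = true ∷ zeros n
unit {suc n} (Fin.suc i) = false ∷ unit i

lookup-unit-≡ : ∀ {n} (i : Fin n) → lookup (unit i) i ≡ true
lookup-unit-≡ Fin.zero    = refl
lookup-unit-≡ (Fin.suc i) = lookup-unit-≡ i

lookup-unit-≢ : ∀ {n} {i j : Fin n} → j ≢ i → lookup (unit i) j ≡ false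
lookup-unit-≢ {i = Fin.zero}  {Fin.zero}  j≢i = ⊥-elim (j≢i refl)
lookup-unit-≢ {i = Fin.zero}  {Fin.suc j} j≢i = lookup-replicate j false
lookup-unit-≢ {i = Fin.suc i} {Fin.zero}  j≢i = refl
lookup-unit-≢ {i = Fin.suc i} {Fin.suc j} j≢i = lookup-unit-≢ (λ j≡i → j≢i (cong Fin.suc j≡i))

lookup-unit-relabel : ∀ {n} {g : Fin n → Fin n} → (∀ {i j} → g i ≡ g j → i ≡ j) →
                        ∀ i j → lookup (unit (g i)) (g j) ≡ lookup (unit i) j
lookup-unit-relabel {g = g} g-injective i j with j ≟ᶠ i
... | yes refl = trans (lookup-unit-≡ (g j)) (sym (lookup-unit-≡ j))
... | no  j≢i  = trans (lookup-unit-≢ (λ gj≡gi → j≢i (g-injective gj≡gi))) (sym (lookup-unit-≢ j≢i))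

unit-induction : ∀ {n} (K : Vec Bool n → Set) → K (zeros n) → (∀ {x y} → K x → K y → K (x ⊕ y)) →
                 (∀ i → K (unit i)) → ∀ x → K x
unit-induction K K0 K⊕ Kunit []      = K0
unit-induction {suc n} K K0 K⊕ Kunit (b ∷ y) = extend b
  where
    K-false∷y : K (false ∷ y)
    K-false∷y = unit-induction (λ v → K (false ∷ v)) K0 K⊕ (λ i → Kunit (Fin.suc i)) y
    extend : ∀ b → K (b ∷ y)
    extend false = K-false∷y
    extend true  =
      subst (λ v → K (true ∷ v)) (zipWith-identityˡ (λ _ → refl) y) (K⊕ (Kunit Fin.zero) K-false∷y)

ones-unit : ∀ {n} (i : Fin n) → ones (unit i) ≡ 1
ones-unit {suc n} Fin.zero    = cong suc (ones-zeros n)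
  where
    ones-zeros : ∀ n → ones (zeros n) ≡ 0
    ones-zeros zero    = refl
    ones-zeros (suc n) = ones-zeros n
ones-unit (Fin.suc i) = ones-unit i

ones≡1⇒unit : ∀ {n} (e : Vec Bool n) → ones e ≡ 1 → ∃ λ i → e ≡ unit i
ones≡1⇒unit (true ∷ e)  ones≡1 = Fin.zero , cong (true ∷_) (ones≡0⇒zeros e (suc-injective ones≡1))
  where
    ones≡0⇒zeros : ∀ {n} (e : Vec Bool n) → ones e ≡ 0 → e ≡ zeros n
    ones≡0⇒zeros []          _      = refl
    ones≡0⇒zeros (false ∷ e) ones≡0 = cong (false ∷_) (ones≡0⇒zeros e ones≡0)
ones≡1⇒unit (false ∷ e) ones≡1 =
  let i , e≡unit = ones≡1⇒unit e ones≡1 in Fin.suc i , cong (false ∷_) e≡unit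

%-absorbʳ : ∀ a b d .{{_ : NonZero d}} → (a + b % d) % d ≡ (a + b) % d
%-absorbʳ a b d = begin
  (a + b % d) % d          ≡⟨ %-distribˡ-+ a (b % d) d ⟩
  (a % d + b % d % d) % d  ≡⟨ cong (λ z → (a % d + z) % d) (m%n%n≡m%n b d) ⟩
  (a % d + b % d) % d      ≡⟨ %-distribˡ-+ a b d ⟨
  (a + b) % d              ∎
  where open ≡-Reasoning

%-absorbˡ : ∀ a b d .{{_ : NonZero d}} → (a % d + b) % d ≡ (a + b) % d
%-absorbˡ a b d = trans (cong (_% d) (+-comm (a % d) b)) (trans (%-absorbʳ b a d) (cong (_% d) (+-comm b a)))

-- Adding d ∸ v % d undoes adding v, modulo d.
+-%-cancelˡ : ∀ v {a b d} .{{_ : NonZero d}} → a < d → b < d → (v + a) % d ≡ (v + b) % d → a ≡ b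
+-%-cancelˡ v {a} {b} {d} a<d b<d same = trans (sym (undo a<d)) (trans (cong (λ z → (w + z) % d) same) (undo b<d))
  where
    w = d ∸ v % d
    w+v≡0 : (w + v) % d ≡ 0
    w+v≡0 = trans (sym (%-absorbʳ w v d)) (trans (cong (_% d) (m∸n+n≡m (<⇒≤ (m%n<n v d)))) (n%n≡0 d))
    undo : ∀ {e} → e < d → (w + (v + e) % d) % d ≡ e
    undo {e} e<d = begin
      (w + (v + e) % d) % d  ≡⟨ %-absorbʳ w (v + e) d ⟩
      (w + (v + e)) % d      ≡⟨ cong (_% d) (+-assoc w v e) ⟨
      (w + v + e) % d        ≡⟨ %-absorbˡ (w + v) e d ⟨
      ((w + v) % d + e) % d  ≡⟨ cong (λ z → (z + e) % d) w+v≡0 ⟩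
      e % d                  ≡⟨ m<n⇒m%n≡m e<d ⟩
      e                      ∎
      where open ≡-Reasoning

module _ {m : ℕ} where
  private
    N : ℕ
    N = suc m

    diffMod-spec : ∀ (i j : Fin N) → (toℕ i + toℕ (diffMod i j)) % N ≡ toℕ j
    diffMod-spec i j = begin
      (toℕ i + toℕ (diffMod i j)) % N        ≡⟨ cong (λ z → (toℕ i + z) % N) (toℕ-fromℕ< _) ⟩
      (toℕ i + (toℕ j + N ∸ toℕ i) % N) % N  ≡⟨ %-absorbʳ (toℕ i) _ N ⟩
      (toℕ i + (toℕ j + N ∸ toℕ i)) % N      ≡⟨ cong (_% N) (m+[n∸m]≡n i≤j+N) ⟩
      (toℕ j + N) % N                        ≡⟨ [m+n]%n≡m%n (toℕ j) N ⟩
      toℕ j % N                              ≡⟨ m<n⇒m%n≡m (toℕ<n j) ⟩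
      toℕ j                                  ∎
      where
        open ≡-Reasoning
        i≤j+N : toℕ i ≤ toℕ j + N
        i≤j+N = ≤-trans (<⇒≤ (toℕ<n i)) (m≤n+m N (toℕ j))

  next : Fin (suc m) → Fin (suc m)
  next j = suc (toℕ j) mod N

  private
    toℕ-next : ∀ j → toℕ (next j) ≡ suc (toℕ j) % N
    toℕ-next j = toℕ-fromℕ< _

  next-injective : ∀ {i j} → next i ≡ next j → i ≡ j
  next-injective {i} {j} same = toℕ-injective (+-%-cancelˡ 1 (toℕ<n i) (toℕ<n j)
    (trans (sym (toℕ-next i)) (trans (cong toℕ same) (toℕ-next j))))

  next-fromℕ : next (fromℕ m) ≡ Fin.zero
  next-fromℕ = toℕ-injective
    (trans (toℕ-next (fromℕ m)) (trans (cong (λ z → suc z % N) (toℕ-fromℕ m)) (n%n≡0 N)))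

  next-inject₁ : ∀ (j : Fin m) → next (inject₁ j) ≡ Fin.suc j
  next-inject₁ j = toℕ-injective
    (trans (toℕ-next (inject₁ j))
           (trans (cong (λ z → suc z % N) (toℕ-inject₁ j)) (m<n⇒m%n≡m (s<s (toℕ<n j)))))

  toℕ-iter-next : ∀ r j → toℕ (iter next r j) ≡ (toℕ j + r) % N
  toℕ-iter-next zero    j = sym (trans (cong (_% N) (+-identityʳ (toℕ j))) (m<n⇒m%n≡m (toℕ<n j)))
  toℕ-iter-next (suc r) j = begin
    toℕ (next (iter next r j))     ≡⟨ toℕ-next _ ⟩
    (1 + toℕ (iter next r j)) % N  ≡⟨ cong (λ z → (1 + z) % N) (toℕ-iter-next r j) ⟩
    (1 + (toℕ j + r) % N) % N      ≡⟨ %-absorbʳ 1 (toℕ j + r) N ⟩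
    (1 + (toℕ j + r)) % N          ≡⟨ cong (_% N) (+-suc (toℕ j) r) ⟨
    (toℕ j + suc r) % N            ∎
    where open ≡-Reasoning

  iter-next-diffMod : ∀ i j → iter next (toℕ (diffMod i j)) i ≡ j
  iter-next-diffMod i j = toℕ-injective (trans (toℕ-iter-next _ i) (diffMod-spec i j))

  diffMod-next : ∀ i j → diffMod (next i) (next j) ≡ diffMod i j
  diffMod-next i j = toℕ-injective (+-%-cancelˡ (toℕ (next i)) (toℕ<n _) (toℕ<n _) (begin
    (toℕ (next i) + toℕ (diffMod (next i) (next j))) % N  ≡⟨ diffMod-spec (next i) (next j) ⟩
    toℕ (next j)                                         ≡⟨ toℕ-next j ⟩
    (1 + toℕ j) % N                                      ≡⟨ cong (λ z → (1 + z) % N) (diffMod-spec i j) ⟨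
    (1 + (toℕ i + d) % N) % N                            ≡⟨ %-absorbʳ 1 (toℕ i + d) N ⟩
    (1 + toℕ i + d) % N                                  ≡⟨ %-absorbˡ (1 + toℕ i) d N ⟨
    ((1 + toℕ i) % N + d) % N                            ≡⟨ cong (λ z → (z + d) % N) (toℕ-next i) ⟨
    (toℕ (next i) + d) % N                               ∎))
    where
      open ≡-Reasoning
      d = toℕ (diffMod i j)

  rotate : Vec Bool (suc m) → Vec Bool (suc m)
  rotate x = tabulate (λ j → lookup x (next j))

  xorSum-next : ∀ (g : Fin (suc m) → Bool) → xorSum (tabulate (λ j → g (next j))) ≡ xorSum (tabulate g)
  xorSum-next g = trans (xorSum-last m (λ j → g (next j)))
    (cong₂ _xor_ (cong g next-fromℕ) (cong xorSum (tabulate-cong λ j → cong g (next-inject₁ j))))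

  F-rotate : ∀ (c : Vec Bool (suc m)) x → F c (rotate x) ≡ rotate (F c x)
  F-rotate c x = lookup-ext λ i → begin
    lookup (F c (rotate x)) i
      ≡⟨ lookup-F c (rotate x) i ⟩
    xorSum (tabulate (λ j → circ c i j ∧ lookup (rotate x) j))
      ≡⟨ cong xorSum (tabulate-cong λ j →
           cong₂ _∧_ (cong (lookup c) (sym (diffMod-next i j)))
                     (lookup∘tabulate (λ l → lookup x (next l)) j)) ⟩
    xorSum (tabulate (λ j → circ c (next i) (next j) ∧ lookup x (next j)))
      ≡⟨ xorSum-next (λ j → circ c (next i) j ∧ lookup x j) ⟩
    xorSum (tabulate (λ j → circ c (next i) j ∧ lookup x j))
      ≡⟨ lookup-F c x (next i) ⟨
    lookup (F c x) (next i)
      ≡⟨ lookup∘tabulate (λ l → lookup (F c x) (next l)) i ⟨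
    lookup (rotate (F c x)) i ∎
    where open ≡-Reasoning

  rotate-unit : ∀ i → rotate (unit (next i)) ≡ unit i
  rotate-unit i = lookup-ext λ j →
    trans (lookup∘tabulate (λ l → lookup (unit (next i)) (next l)) j) (lookup-unit-relabel next-injective i j)

  rotate-closed⇒units : (K : Vec Bool (suc m) → Set) → (∀ {x} → K x → K (rotate x)) →
                        ∀ {i} → K (unit i) → ∀ j → K (unit j)
  rotate-closed⇒units K K-rotate {i} K-unit-i j =
    back (toℕ (diffMod j i)) (subst (λ l → K (unit l)) (sym (iter-next-diffMod j i)) K-unit-i)
    where
      back : ∀ r {j} → K (unit (iter next r j)) → K (unit j)
      back zero    K-unit = K-unit
      back (suc r) K-unit = back r (subst K (rotate-unit _) (K-rotate K-unit))

  iter-F-determined-by-unit : ∀ (c : Vec Bool (suc m)) e → ones e ≡ 1 → ∀ a b →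
                              iter (F c) a e ≡ iter (F c) b e → ∀ x → iter (F c) a x ≡ iter (F c) b x
  iter-F-determined-by-unit c e ones≡1 a b agree-e = unit-induction Agree agree-zeros agree-⊕ agree-units
    where
      Agree : Vec Bool (suc m) → Set
      Agree x = iter (F c) a x ≡ iter (F c) b x
      agree-zeros : Agree (zeros (suc m))
      agree-zeros = trans (iter-fixed (F c) (F-zeros c) a) (sym (iter-fixed (F c) (F-zeros c) b))
      agree-⊕ : ∀ {x y} → Agree x → Agree y → Agree (x ⊕ y)
      agree-⊕ {x} {y} agree-x agree-y = begin
        iter (F c) a (x ⊕ y)                ≡⟨ iter-homo₂ (F c) _⊕_ (F-⊕ c) a x y ⟩
        iter (F c) a x ⊕ iter (F c) a y     ≡⟨ cong₂ _⊕_ agree-x agree-y ⟩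
        iter (F c) b x ⊕ iter (F c) b y     ≡⟨ iter-homo₂ (F c) _⊕_ (F-⊕ c) b x y ⟨
        iter (F c) b (x ⊕ y)                ∎
        where open ≡-Reasoning
      agree-rotate : ∀ {x} → Agree x → Agree (rotate x)
      agree-rotate {x} agree-x = begin
        iter (F c) a (rotate x)   ≡⟨ iter-commute (F c) rotate (F-rotate c) a x ⟩
        rotate (iter (F c) a x)   ≡⟨ cong rotate agree-x ⟩
        rotate (iter (F c) b x)   ≡⟨ iter-commute (F c) rotate (F-rotate c) b x ⟨
        iter (F c) b (rotate x)   ∎
        where open ≡-Reasoning
      agree-units : ∀ j → Agree (unit j)
      agree-units = let _ , e≡unit = ones≡1⇒unit e ones≡1 in
        rotate-closed⇒units Agree agree-rotate (subst Agree e≡unit agree-e)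

onCycle⇒periodicFrom : ∀ {n} (c : Vec Bool n) x s → OnCycle c (iter (F c) s x) →
                       ∃ λ q → 0 < q × PeriodicFrom (F c) x s q
onCycle⇒periodicFrom c x s (q , q>0 , returns) = q , q>0 , trans (iter-+-comm (F c) x s q) returns

periodicFrom⇒onCycle : ∀ {n} (c : Vec Bool n) x s p → 0 < p → PeriodicFrom (F c) x s p →
                       OnCycle c (iter (F c) s x)
periodicFrom⇒onCycle c x s p p>0 periodic = p , p>0 , trans (sym (iter-+-comm (F c) x s p)) periodic

unitTransient-maximal : ∀ {m} (c : Vec Bool (suc m)) e → ones e ≡ 1 →
  Σ ℕ λ T → IsConvTime c e T × ((x : Config (suc m)) (t : ℕ) → IsConvTime c x t → t ≤ T)
unitTransient-maximal c e ones≡1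
  with t₀ , p , p>0 , periodic-t₀ ← eventually-periodic (F c) e
  with T , periodic-T , aperiodic-before-T ← least-witness (λ s → ≡-dec _≟ᵇ_ _ _) t₀ periodic-t₀ =
  T , (periodicFrom⇒onCycle c e T p p>0 periodic-T , before-T) , T-bound
  where
    before-T : ∀ s → s < T → ¬ OnCycle c (iter (F c) s e)
    before-T s s<T on-cycle = let q , q>0 , periodic-q = onCycle⇒periodicFrom c e s on-cycle in
      aperiodic-before-T s s<T (periodicFrom-swapPeriod (F c) e s q T p q>0 periodic-q periodic-T)
    T-bound : ∀ x t → IsConvTime c x t → t ≤ T
    T-bound x t (_ , not-yet) = ≮⇒≥ λ T<t →
      not-yet T T<t (periodicFrom⇒onCycle c x T p p>0
                       (iter-F-determined-by-unit c e ones≡1 (T + p) T periodic-T x))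

period-∣-unitPeriod : ∀ {m} (c : Vec Bool (suc m)) e → ones e ≡ 1 → ∀ pstar → IsPeriod c e pstar →
                      ∀ x p → IsPeriod c x p → p ∣ pstar
period-∣-unitPeriod c e ones≡1 pstar (_ , (t , periodic-e) , _) x p (p>0 , (u , periodic-x) , minimal) =
  minimalPeriod-∣ (F c) x u p t pstar p>0 periodic-x minimal
    (iter-F-determined-by-unit c e ones≡1 (t + pstar) t periodic-e x)

proposition4 : (k n : ℕ) (c : Vec Bool n) → IsKXorCirculant k n c →
    (Σ (Config n) λ e → (ones e ≡ 1) × Σ ℕ λ T → IsConvTime c e T
    × ((x : Config n) (t : ℕ) → IsConvTime c x t → t ≤ T))
    × ((e : Config n) → ones e ≡ 1 → (pstar : ℕ) → IsPeriod c e pstar →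
    (x : Config n) (p : ℕ) → IsPeriod c x p → p ∣ pstar)
proposition4 k zero    c (2≤k , k≤0 , _) = contradiction (≤-trans 2≤k k≤0) λ ()
proposition4 k (suc m) c _ =
  (unit Fin.zero , ones-e , unitTransient-maximal c (unit Fin.zero) ones-e) , period-∣-unitPeriod c
  where
    ones-e : ones (unit {suc m} Fin.zero) ≡ 1
    ones-e = ones-unit {suc m} Fin.zero
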